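{- For every $n\ge1$, let $F_n$ denote the set of fractions at level $n$ of the Calkin–Wilf tree. Then $\sum_{r\in F_n} r=\sum_{r\in F_n} ?(r)$.
   Context: The Calkin–Wilf tree is the rooted infinite binary tree whose vertices are labeled by fractions: the root is $\frac{1}{1}$ (at level $1$), and a vertex labeled $\frac{a}{b}$ at level $k$ has children $\frac{a}{a+b}$ and $\frac{a+b}{b}$ at level $k+1$. The Minkowski question-mark function is defined on rationals by $?(y)=a_0+2\sum_{k=1}^{m}\frac{(-1)^{k+1}}{2^{a_1+\cdots+a_k}}$, where $y=[a_0;a_1,\ldots,a_m]$ is a finite simple continued fraction of $y$ ($a_0\in\mathbb{Z}$, $a_1,\ldots,a_m$ positive integers). -}

module Defs where

open import Data.Nat as ℕ using (ℕ; zero; suc; _+_; _^_; _/_; _%_)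
open import Data.Nat.Properties using (m^n≢0)
open import Data.Integer using (+_)
open import Data.Rational as ℚ using (ℚ; 0ℚ; 1ℚ; -_)
open import Data.List using (List; []; _∷_; concatMap; map; foldr)
open import Data.Bool using (Bool; true; false; not)
open import Data.Product using (_×_; _,_)

-- A Calkin–Wilf label a/b (a, b positive) is stored as the pair (a , d)
-- with b = suc d, i.e. it denotes the fraction a / (d + 1).
Label : Set
Label = ℕ × ℕ

toℚ : Label → ℚ
toℚ (a , d) = + a ℚ./ suc d

children : Label → List Label
children (a , d) = (a , a + d) ∷ (a + suc d , d) ∷ []

-- vertices of level n of the Calkin–Wilf tree (root 1/1 at level 1);
-- level 0 is empty (not part of the tree).
level : ℕ → List Label
level zero          = []
level (suc zero)    = (1 , 0) ∷ []
level (suc (suc k)) = concatMap children (level (suc k))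

-- simple continued fraction [a₀; a₁, …, aₘ] of a/(suc d) via the Euclidean
-- algorithm; the fuel (suc d) suffices since the denominators strictly decrease.
cfAux : ℕ → ℕ → ℕ → List ℕ
cfAux zero       a d = []
cfAux (suc fuel) a d with a % suc d
... | zero   = a / suc d ∷ []
... | suc r  = a / suc d ∷ cfAux fuel (suc d) r

contFrac : Label → List ℕ
contFrac (a , d) = cfAux (suc d) a d

invPow2 : ℕ → ℚ
invPow2 n = ℚ._/_ (+ 1) (2 ^ n) {{m^n≢0 2 n}}

-- Σ_{k ≥ 1} (-1)^{k+1} / 2^{a₁+⋯+aₖ} over the list [a₁,…,aₘ];
-- s = a₁+⋯+a_{k-1} is the partial sum so far, the Bool is true iff the
-- current sign (-1)^{k+1} is +1.
qmTail : Bool → ℕ → List ℕ → ℚ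
qmTail b s []       = 0ℚ
qmTail b s (a ∷ as) = sgn b (invPow2 (s + a)) ℚ.+ qmTail (not b) (s + a) as
  where
  sgn : Bool → ℚ → ℚ
  sgn true  q = q
  sgn false q = - q

-- Minkowski ?(y) = a₀ + 2 Σ_{k=1}^m (-1)^{k+1} / 2^{a₁+⋯+aₖ}, y = [a₀; a₁, …, aₘ]
questionMarkCF : List ℕ → ℚ
questionMarkCF []       = 0ℚ
questionMarkCF (a₀ ∷ as) = + a₀ ℚ./ 1 ℚ.+ (+ 2 ℚ./ 1) ℚ.* qmTail true 0 as

questionMark : Label → ℚ
questionMark r = questionMarkCF (contFrac r)

sumℚ : List ℚ → ℚ
sumℚ = foldr ℚ._+_ 0ℚ

module Submission where

-- Write a vertex as A/B.  Its children are left = A/(A+B) and right = (A+B)/B,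
-- and flip A/B = B/A.  Both f = id and f = ? satisfy
--   (R) f (right x) = f x + 1          and
--   (L) f (left x) + f (left (flip x)) = 1      (i.e. f(t) + f(1 - t) = 1).
-- Since every level is closed under flip, (L) shows that the left children of
-- level k contribute exactly N/2 to level k+1 (N = size of level k), and (R)
-- shows that the right children contribute (level-k sum) + N.  Hence any two
-- functions satisfying (R) and (L) which agree at the root 1/1 have the same
-- level sums, by induction on the level.

open import Defs
open import Data.Nat as ℕ using (ℕ; zero; suc; _≤_; _<_; s≤s)
open import Data.Nat.DivMod
open import Data.Nat.Tactic.RingSolver using (solve-∀)
import Data.Nat.Properties as ℕP
open import Data.Integer as ℤ using (+_)
import Data.Integer.Properties as ℤP
open import Data.Rational as ℚ using (ℚ; 0ℚ; 1ℚ; -_; _+_; _*_; toℚᵘ)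
import Data.Rational.Properties as ℚP
open import Data.Rational.Unnormalised as ℚᵘ using (mkℚᵘ; *≡*)
import Data.Rational.Unnormalised.Properties as ℚᵘP
open import Data.Rational.Solver using (module +-*-Solver)
open import Data.List using (List; []; _∷_; map; concatMap)
import Data.List.Properties as ListP
open import Data.Bool using (true; false; not)
open import Data.Product using (_×_; _,_; ∃₂)
open import Relation.Binary using (tri<; tri≈; tri>)
open import Relation.Binary.PropositionalEquality
open +-*-Solver using (solve; _:+_; _:*_; :-_; _:=_)

-- The tree indexed by pairs of naturals

-- The vertex (a , b) stands for the fraction (a+1)/(b+1); unlike Label it
-- only describes positive numerators, which makes flip a total operation.
Vertex : Set
Vertex = ℕ × ℕ

label : Vertex → Label
label (a , b) = (suc a , b)

root : Vertex
root = (0 , 0)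

left right flip : Vertex → Vertex
left  (a , b) = (a , suc a ℕ.+ b)
right (a , b) = (a ℕ.+ suc b , b)
flip  (a , b) = (b , a)

childrenOf : Vertex → List Vertex
childrenOf x = left x ∷ right x ∷ []

-- vertices k is level k+1 of the tree.
vertices : ℕ → List Vertex
vertices zero    = root ∷ []
vertices (suc k) = concatMap childrenOf (vertices k)

level-vertices : ∀ k → level (suc k) ≡ map label (vertices k)
level-vertices zero    = refl
level-vertices (suc k) = trans (cong (concatMap children) (level-vertices k))
                               (children-label (vertices k))
  where
  children-label : ∀ xs → concatMap children (map label xs) ≡ map label (concatMap childrenOf xs)
  children-label []       = refl
  children-label (x ∷ xs) = cong (λ ys → label (left x) ∷ label (right x) ∷ ys) (children-label xs)

flip-left : ∀ x → flip (left x) ≡ right (flip x)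
flip-left (a , b) = cong (_, a) (ℕP.+-comm (suc a) b)

flip-right : ∀ x → flip (right x) ≡ left (flip x)
flip-right (a , b) = cong (b ,_) (ℕP.+-comm a (suc b))

sumOver : (Vertex → ℚ) → List Vertex → ℚ
sumOver f xs = sumℚ (map f xs)

count : List Vertex → ℚ
count = sumOver (λ _ → 1ℚ)

sumOver-cong : ∀ {f g} xs → (∀ x → f x ≡ g x) → sumOver f xs ≡ sumOver g xs
sumOver-cong []       f≗g = refl
sumOver-cong (x ∷ xs) f≗g = cong₂ _+_ (f≗g x) (sumOver-cong xs f≗g)

sumOver-+ : ∀ f g xs → sumOver (λ x → f x + g x) xs ≡ sumOver f xs + sumOver g xs
sumOver-+ f g []       = refl
sumOver-+ f g (x ∷ xs) = trans (cong (_+_ (f x + g x)) (sumOver-+ f g xs))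
  (solve 4 (λ p q r s → (p :+ q) :+ (r :+ s) := (p :+ r) :+ (q :+ s)) refl
     (f x) (g x) (sumOver f xs) (sumOver g xs))

sumOver-children : ∀ f xs →
  sumOver f (concatMap childrenOf xs) ≡ sumOver (λ x → f (left x) + f (right x)) xs
sumOver-children f []       = refl
sumOver-children f (x ∷ xs) =
  trans (sym (ℚP.+-assoc (f (left x)) (f (right x)) _))
        (cong (_+_ (f (left x) + f (right x))) (sumOver-children f xs))

-- Every level is closed under flip, so level sums are flip-invariant.
sumOver-flip : ∀ k h → sumOver h (vertices k) ≡ sumOver (λ x → h (flip x)) (vertices k)
sumOver-flip zero    h = refl
sumOver-flip (suc k) h = begin
    sumOver h (vertices (suc k))
  ≡⟨ sumOver-children h (vertices k) ⟩
    sumOver (λ x → h (left x) + h (right x)) (vertices k)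
  ≡⟨ sumOver-flip k (λ x → h (left x) + h (right x)) ⟩
    sumOver (λ x → h (left (flip x)) + h (right (flip x))) (vertices k)
  ≡⟨ sumOver-cong (vertices k) swap-children ⟩
    sumOver (λ x → h (flip (left x)) + h (flip (right x))) (vertices k)
  ≡⟨ sym (sumOver-children (λ x → h (flip x)) (vertices k)) ⟩
    sumOver (λ x → h (flip x)) (vertices (suc k)) ∎
  where
  open ≡-Reasoning
  swap-children : ∀ x → h (left (flip x)) + h (right (flip x)) ≡ h (flip (left x)) + h (flip (right x))
  swap-children x = trans (ℚP.+-comm (h (left (flip x))) _)
    (cong₂ _+_ (cong h (sym (flip-left x))) (cong h (sym (flip-right x))))

-- The comparison principle

record Balanced (f : Vertex → ℚ) : Set where
  field
    right-shift     : ∀ x → f (right x) ≡ f x + 1ℚ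
    left-complement : ∀ x → f (left x) + f (left (flip x)) ≡ 1ℚ

½ : ℚ
½ = invPow2 1

cancel-double : ∀ p q → p + p ≡ q + q → p ≡ q
cancel-double p q p+p≡q+q = trans (halve p) (trans (cong (½ *_) p+p≡q+q) (sym (halve q)))
  where
  halve : ∀ r → r ≡ ½ * (r + r)
  halve = solve 1 (λ r → r := +-*-Solver.con ½ :* (r :+ r)) refl

module _ {f : Vertex → ℚ} (balanced : Balanced f) where
  open Balanced balanced

  left-sum-doubled : ∀ k →
    sumOver (λ x → f (left x)) (vertices k) + sumOver (λ x → f (left x)) (vertices k)
      ≡ count (vertices k)
  left-sum-doubled k =
    trans (cong (_+_ (sumOver (λ x → f (left x)) (vertices k))) (sumOver-flip k (λ x → f (left x))))
      (trans (sym (sumOver-+ (λ x → f (left x)) (λ x → f (left (flip x))) (vertices k)))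
             (sumOver-cong (vertices k) left-complement))

  level-sum-step : ∀ k → sumOver f (vertices (suc k))
    ≡ sumOver (λ x → f (left x)) (vertices k) + (sumOver f (vertices k) + count (vertices k))
  level-sum-step k =
    trans (sumOver-children f (vertices k))
      (trans (sumOver-+ (λ x → f (left x)) (λ x → f (right x)) (vertices k))
        (cong (_+_ (sumOver (λ x → f (left x)) (vertices k)))
          (trans (sumOver-cong (vertices k) right-shift) (sumOver-+ f (λ _ → 1ℚ) (vertices k)))))

level-sums-agree : ∀ {f g} → Balanced f → Balanced g → f root ≡ g root →
                   ∀ k → sumOver f (vertices k) ≡ sumOver g (vertices k)
level-sums-agree bf bg same-root zero    = cong (_+ 0ℚ) same-root
level-sums-agree {f} {g} bf bg same-root (suc k) = begin
    sumOver f (vertices (suc k))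
  ≡⟨ level-sum-step bf k ⟩
    sumOver f∘left (vertices k) + (sumOver f (vertices k) + count (vertices k))
  ≡⟨ cong₂ (λ p q → p + (q + count (vertices k))) same-left (level-sums-agree bf bg same-root k) ⟩
    sumOver g∘left (vertices k) + (sumOver g (vertices k) + count (vertices k))
  ≡⟨ sym (level-sum-step bg k) ⟩
    sumOver g (vertices (suc k)) ∎
  where
  open ≡-Reasoning
  f∘left g∘left : Vertex → ℚ
  f∘left x = f (left x)
  g∘left x = g (left x)
  same-left : sumOver f∘left (vertices k) ≡ sumOver g∘left (vertices k)
  same-left = cancel-double _ _ (trans (left-sum-doubled bf k) (sym (left-sum-doubled bg k)))

-- The value of a vertex is balanced

fraction : ℕ → ℕ → ℚ
fraction m d = + m ℚ./ suc d

fraction-toℚᵘ : ∀ m d → toℚᵘ (fraction m d) ℚᵘ.≃ mkℚᵘ (+ m) d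
fraction-toℚᵘ m d = ℚP.toℚᵘ-fromℚᵘ (mkℚᵘ (+ m) d)

fraction-≡ : ∀ m d n e → m ℕ.* suc e ≡ n ℕ.* suc d → fraction m d ≡ fraction n e
fraction-≡ m d n e cross = ℚP.toℚᵘ-injective (ℚᵘP.≃-trans (fraction-toℚᵘ m d)
  (ℚᵘP.≃-trans (*≡* (trans (sym (ℤP.pos-* m (suc e))) (trans (cong +_ cross) (ℤP.pos-* n (suc d)))))
               (ℚᵘP.≃-sym (fraction-toℚᵘ n e))))

fraction-+ : ∀ m d n e → fraction m d + fraction n e
                       ≡ fraction (m ℕ.* suc e ℕ.+ n ℕ.* suc d) (ℕ.pred (suc d ℕ.* suc e))
fraction-+ m d n e = ℚP.toℚᵘ-injective (ℚᵘP.≃-trans (ℚP.toℚᵘ-homo-+ (fraction m d) (fraction n e))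
  (ℚᵘP.≃-trans (ℚᵘP.+-cong (fraction-toℚᵘ m d) (fraction-toℚᵘ n e))
    (ℚᵘP.≃-trans (ℚᵘP.≃-reflexive (cong (λ z → mkℚᵘ z (ℕ.pred (suc d ℕ.* suc e))) numerator))
                 (ℚᵘP.≃-sym (fraction-toℚᵘ _ _)))))
  where
  numerator : + m ℤ.* + suc e ℤ.+ + n ℤ.* + suc d ≡ + (m ℕ.* suc e ℕ.+ n ℕ.* suc d)
  numerator = trans (cong₂ ℤ._+_ (sym (ℤP.pos-* m (suc e))) (sym (ℤP.pos-* n (suc d))))
                    (sym (ℤP.pos-+ (m ℕ.* suc e) (n ℕ.* suc d)))

fraction-add-denominator : ∀ m d → fraction (m ℕ.+ suc d) d ≡ fraction m d + 1ℚ
fraction-add-denominator m d =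
  trans (fraction-≡ (m ℕ.+ suc d) d (m ℕ.* 1 ℕ.+ 1 ℕ.* suc d) (d ℕ.* 1) (cross m d))
        (sym (fraction-+ m d 1 0))
  where
  cross : ∀ m d → (m ℕ.+ suc d) ℕ.* suc (d ℕ.* 1) ≡ (m ℕ.* 1 ℕ.+ 1 ℕ.* suc d) ℕ.* suc d
  cross = solve-∀

value : Vertex → ℚ
value x = toℚ (label x)

value-balanced : Balanced value
value-balanced = record { right-shift = shift ; left-complement = complement }
  where
  shift : ∀ x → value (right x) ≡ value x + 1ℚ
  shift (a , b) = fraction-add-denominator (suc a) b
  complement : ∀ x → value (left x) + value (left (flip x)) ≡ 1ℚ
  complement (a , b) = trans (fraction-+ (suc a) (suc a ℕ.+ b) (suc b) (suc b ℕ.+ a))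
                             (fraction-≡ (suc a ℕ.* suc (suc b ℕ.+ a) ℕ.+ suc b ℕ.* suc (suc a ℕ.+ b))
                                          ((suc b ℕ.+ a) ℕ.+ (suc a ℕ.+ b) ℕ.* suc (suc b ℕ.+ a)) 1 0 (cross a b))
    where
    cross : ∀ a b → (suc a ℕ.* suc (suc b ℕ.+ a) ℕ.+ suc b ℕ.* suc (suc a ℕ.+ b)) ℕ.* 1
                  ≡ 1 ℕ.* suc ((suc b ℕ.+ a) ℕ.+ (suc a ℕ.+ b) ℕ.* suc (suc b ℕ.+ a))
    cross = solve-∀

-- Continued fractions of children

cfAux-step : ∀ f a d r → a % suc d ≡ suc r → cfAux (suc f) a d ≡ a / suc d ∷ cfAux f (suc d) r
cfAux-step f a d r eq with a % suc d
cfAux-step f a d r refl | .(suc r) = refl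

cfAux-last : ∀ f a d → a % suc d ≡ 0 → cfAux (suc f) a d ≡ a / suc d ∷ []
cfAux-last f a d eq with a % suc d
cfAux-last f a d refl | .0 = refl

cfAux-fuel : ∀ f g a d → d < f → d < g → cfAux f a d ≡ cfAux g a d
cfAux-fuel (suc f) (suc g) a d d<f d<g with a % suc d in eq
... | zero  = refl
... | suc r = cong (a / suc d ∷_) (cfAux-fuel f g (suc d) r (r<fuel d<f) (r<fuel d<g))
  where
  r<d : r < d
  r<d = ℕP.≤-pred (subst (_< suc d) eq (m%n<n a (suc d)))
  r<fuel : ∀ {h} → d < suc h → r < h
  r<fuel d<h = ℕP.<-≤-trans r<d (ℕP.≤-pred d<h)

incrementHead : List ℕ → List ℕ
incrementHead []       = []
incrementHead (c ∷ cs) = suc c ∷ cs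

quotient-add-divisor : ∀ m d → (m ℕ.+ suc d) / suc d ≡ suc (m / suc d)
quotient-add-divisor m d =
  trans (m/n≡1+[m∸n]/n (ℕP.m≤n+m (suc d) m)) (cong (λ k → suc (k / suc d)) (ℕP.m+n∸n≡m m (suc d)))

cfAux-add-denominator : ∀ f m d → cfAux (suc f) (m ℕ.+ suc d) d ≡ incrementHead (cfAux (suc f) m d)
cfAux-add-denominator f m d with m % suc d in eq
... | zero  = trans (cfAux-last f (m ℕ.+ suc d) d (trans ([m+n]%n≡m%n m (suc d)) eq))
                    (cong (_∷ []) (quotient-add-divisor m d))
... | suc r = trans (cfAux-step f (m ℕ.+ suc d) d r (trans ([m+n]%n≡m%n m (suc d)) eq))
                    (cong (_∷ cfAux f (suc d) r) (quotient-add-divisor m d))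

cf : Vertex → List ℕ
cf x = contFrac (label x)

cf-nonempty : ∀ x → ∃₂ λ c cs → cf x ≡ c ∷ cs
cf-nonempty (a , b) with suc a % suc b
... | zero  = _ , _ , refl
... | suc r = _ , _ , refl

cf-right : ∀ x → cf (right x) ≡ incrementHead (cf x)
cf-right (a , b) = cfAux-add-denominator b (suc a) b

cf-below-one : ∀ a b → a < b → cf (a , b) ≡ 0 ∷ cf (b , a)
cf-below-one a b a<b = trans (cfAux-step b (suc a) b a (m<n⇒m%n≡m (s≤s a<b)))
  (cong₂ _∷_ (m<n⇒m/n≡0 (s≤s a<b)) (cfAux-fuel b (suc a) (suc b) a a<b ℕP.≤-refl))

cf-one : ∀ a → cf (a , a) ≡ 1 ∷ []
cf-one a = trans (cfAux-last a (suc a) a (n%n≡0 (suc a))) (cong (_∷ []) (n/n≡1 (suc a)))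

cf-left : ∀ x → cf (left x) ≡ 0 ∷ incrementHead (cf (flip x))
cf-left (a , b) = begin
    cf (left (a , b))
  ≡⟨ cf-below-one a (suc a ℕ.+ b) (s≤s (ℕP.m≤m+n a b)) ⟩
    0 ∷ cfAux (suc a) (suc (suc a ℕ.+ b)) a
  ≡⟨ cong (λ m → 0 ∷ cfAux (suc a) (suc m) a) (ℕP.+-comm (suc a) b) ⟩
    0 ∷ cfAux (suc a) (suc b ℕ.+ suc a) a
  ≡⟨ cong (0 ∷_) (cfAux-add-denominator a (suc b) a) ⟩
    0 ∷ incrementHead (cf (flip (a , b))) ∎
  where open ≡-Reasoning

-- The question-mark function is balanced

questionMarkV : Vertex → ℚ
questionMarkV x = questionMark (label x)

qmTail-not : ∀ b s as → qmTail (not b) s as ≡ - qmTail b s as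
qmTail-not b s [] = refl
qmTail-not true s (a ∷ as) = trans (cong (λ t → - invPow2 (s ℕ.+ a) + t) (qmTail-not false (s ℕ.+ a) as))
  (solve 2 (λ p t → :- p :+ :- t := :- (p :+ t)) refl (invPow2 (s ℕ.+ a)) (qmTail false (s ℕ.+ a) as))
qmTail-not false s (a ∷ as) = trans (cong (λ t → invPow2 (s ℕ.+ a) + t) (qmTail-not true (s ℕ.+ a) as))
  (solve 2 (λ p t → p :+ :- t := :- (:- p :+ t)) refl (invPow2 (s ℕ.+ a)) (qmTail true (s ℕ.+ a) as))

-- The tails of [0; c+1, cs] and [0; 1, c, cs] (which are t and 1 - t) add up to ½.
qmTail-complement : ∀ c cs → qmTail true 0 (suc c ∷ cs) + qmTail true 0 (1 ∷ c ∷ cs) ≡ ½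
qmTail-complement c cs =
  trans (cong (λ t → (invPow2 (suc c) + t) + (½ + (- invPow2 (suc c) + qmTail true (suc c) cs)))
              (qmTail-not true (suc c) cs))
        (solve 3 (λ p t h → (p :+ :- t) :+ (h :+ (:- p :+ t)) := h) refl
               (invPow2 (suc c)) (qmTail true (suc c) cs) ½)

questionMarkCF-increment : ∀ c cs → questionMarkCF (suc c ∷ cs) ≡ questionMarkCF (c ∷ cs) + 1ℚ
questionMarkCF-increment c cs =
  trans (cong (_+ tail) (trans (cong (λ m → fraction m 0) (ℕP.+-comm 1 c))
                               (fraction-add-denominator c 0)))
        (solve 3 (λ p q t → (p :+ q) :+ t := (p :+ t) :+ q) refl (fraction c 0) 1ℚ tail)
  where
  tail : ℚ
  tail = (+ 2 ℚ./ 1) * qmTail true 0 cs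

questionMarkCF-complement : ∀ xs ys → qmTail true 0 xs + qmTail true 0 ys ≡ ½ →
                            questionMarkCF (0 ∷ xs) + questionMarkCF (0 ∷ ys) ≡ 1ℚ
questionMarkCF-complement xs ys tails≡½ =
  trans (solve 3 (λ two p q → (+-*-Solver.con 0ℚ :+ two :* p) :+ (+-*-Solver.con 0ℚ :+ two :* q)
                              := two :* (p :+ q)) refl (+ 2 ℚ./ 1) (qmTail true 0 xs) (qmTail true 0 ys))
        (cong ((+ 2 ℚ./ 1) *_) tails≡½)

-- The alternating tail in ?(left (flip x)); by cf-left that vertex has the
-- expansion [0; incrementHead (cf x)].
leftTail : Vertex → ℚ
leftTail x = qmTail true 0 (incrementHead (cf x))

-- For A < B the two tails come from [0; B/A] and B/A, i.e. from 1 - t and t.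
leftTail-below-one : ∀ a b → a < b → leftTail (b , a) + leftTail (a , b) ≡ ½
leftTail-below-one a b a<b with cf-nonempty (b , a)
... | c , cs , cf≡ = begin
    qmTail true 0 (incrementHead (cf (b , a))) + qmTail true 0 (incrementHead (cf (a , b)))
  ≡⟨ cong (λ ds → qmTail true 0 (incrementHead (cf (b , a))) + qmTail true 0 (incrementHead ds))
          (cf-below-one a b a<b) ⟩
    qmTail true 0 (incrementHead (cf (b , a))) + qmTail true 0 (incrementHead (0 ∷ cf (b , a)))
  ≡⟨ cong (λ ds → qmTail true 0 (incrementHead ds) + qmTail true 0 (incrementHead (0 ∷ ds))) cf≡ ⟩
    qmTail true 0 (suc c ∷ cs) + qmTail true 0 (1 ∷ c ∷ cs)
  ≡⟨ qmTail-complement c cs ⟩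
    ½ ∎
  where open ≡-Reasoning

-- The tails of ?(left x) and ?(left (flip x)) always add up to ½; the case
-- A = B is the direct computation ?(1/2) = 1/2.
leftTail-complement : ∀ x → leftTail (flip x) + leftTail x ≡ ½
leftTail-complement (a , b) with ℕP.<-cmp a b
... | tri< a<b _ _ = leftTail-below-one a b a<b
... | tri≈ _ refl _ =
  cong (λ ds → qmTail true 0 (incrementHead ds) + qmTail true 0 (incrementHead ds)) (cf-one a)
... | tri> _ _ b<a = trans (ℚP.+-comm (leftTail (b , a)) _) (leftTail-below-one b a b<a)

questionMark-balanced : Balanced questionMarkV
questionMark-balanced = record { right-shift = shift ; left-complement = complement }
  where
  shift : ∀ x → questionMarkV (right x) ≡ questionMarkV x + 1ℚ
  shift x with cf-nonempty x
  ... | c , cs , cf≡ = begin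
      questionMarkCF (cf (right x))
    ≡⟨ cong questionMarkCF (trans (cf-right x) (cong incrementHead cf≡)) ⟩
      questionMarkCF (suc c ∷ cs)
    ≡⟨ questionMarkCF-increment c cs ⟩
      questionMarkCF (c ∷ cs) + 1ℚ
    ≡⟨ cong (λ ds → questionMarkCF ds + 1ℚ) (sym cf≡) ⟩
      questionMarkCF (cf x) + 1ℚ ∎
    where open ≡-Reasoning
  complement : ∀ x → questionMarkV (left x) + questionMarkV (left (flip x)) ≡ 1ℚ
  complement x = trans (cong₂ (λ ds es → questionMarkCF ds + questionMarkCF es)
                              (cf-left x) (cf-left (flip x)))
                       (questionMarkCF-complement (incrementHead (cf (flip x))) (incrementHead (cf x))
                         (leftTail-complement x))

mainTheorem7 : (n : ℕ) → 1 ≤ n → sumℚ (map toℚ (level n)) ≡ sumℚ (map questionMark (level n))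
mainTheorem7 (suc k) _ = begin
    sumℚ (map toℚ (level (suc k)))
  ≡⟨ cong (λ xs → sumℚ (map toℚ xs)) (level-vertices k) ⟩
    sumℚ (map toℚ (map label (vertices k)))
  ≡⟨ cong sumℚ (sym (ListP.map-∘ (vertices k))) ⟩
    sumOver value (vertices k)
  ≡⟨ level-sums-agree value-balanced questionMark-balanced refl k ⟩
    sumOver questionMarkV (vertices k)
  ≡⟨ cong sumℚ (ListP.map-∘ (vertices k)) ⟩
    sumℚ (map questionMark (map label (vertices k)))
  ≡⟨ cong (λ xs → sumℚ (map questionMark xs)) (sym (level-vertices k)) ⟩
    sumℚ (map questionMark (level (suc k))) ∎
  where open ≡-Reasoning
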